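{- Let $\mathit{Atm}_0$ be infinite and let $\varphi\in\mathcal{L}$. Then $\varphi$ is satisfiable relative to the class of finite multi-decision models if and only if $\varphi$ is satisfiable relative to the class of finite quasi-multi-decision models.
   Context: Let $\mathit{Atm}_0$ be a countable set of atomic propositions and $\mathit{Val}$ a finite set of output values; decision atoms $\mathsf{t}(x)$ for $x\in\mathit{Val}$, $\mathit{Dec}=\{\mathsf{t}(x):x\in\mathit{Val}\}$, $\mathit{Atm}=\mathit{Atm}_0\cup\mathit{Dec}$. Language $\mathcal{L}$: $\varphi ::= p \mid \mathsf{t}(x)\mid \neg\varphi\mid \varphi\wedge\varphi\mid \Box_{\mathtt{I}}\varphi\mid \Box_{\mathtt{F}}\varphi$ ($p\in\mathit{Atm}_0$, $x\in\mathit{Val}$). A quasi-multi-decision model (quasi-MDM) is a tuple $M=(W,\sim_{\Box_{\mathtt{I}}},\sim_{\Box_{\mathtt{F}}},V)$ with $W$ a set, $\sim_{\Box_{\mathtt{I}}},\sim_{\Box_{\mathtt{F}}}$ equivalence relations on $W$, $V:W\to2^{\mathit{Atm}}$, writing $V_Y(w)=V(w)\cap Y$, such that for all $w,v\in W$, $x,y\in\mathit{Val}$: (C1) $\sim_{\Box_{\mathtt{I}}}\circ\sim_{\Box_{\mathtt{F}}}=\sim_{\Box_{\mathtt{F}}}\circ\sim_{\Box_{\mathtt{I}}}$; (C3) if $w\sim_{\Box_{\mathtt{F}}}v$ then $V_{\mathit{Atm}_0}(w)=V_{\mathit{Atm}_0}(v)$; (C4) if $\mathsf{t}(x)\in V(w)$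 and $x\neq y$ then $\mathsf{t}(y)\notin V(w)$; (C5) some $\mathsf{t}(x)\in V(w)$. A multi-decision model (MDM) is a quasi-MDM that additionally satisfies (C2): if $V_{\mathit{Atm}_0}(w)=V_{\mathit{Atm}_0}(v)$ and $w\sim_{\Box_{\mathtt{I}}}v$ then $V_{\mathit{Dec}}(w)=V_{\mathit{Dec}}(v)$. A (quasi-)MDM is finite if $W$ is finite. Truth: atoms $q\in\mathit{Atm}$ true at $w$ iff $q\in V(w)$; Boolean connectives as usual; $\Box_{\mathtt{I}}\varphi$ (resp. $\Box_{\mathtt{F}}\varphi$) true at $w$ iff $\varphi$ true at all $\sim_{\Box_{\mathtt{I}}}$- (resp. $\sim_{\Box_{\mathtt{F}}}$-) related worlds. Satisfiable relative to a class = true at some world of some model in the class. -}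

module Defs where

open import Data.Nat using (ℕ)
open import Data.Fin using (Fin)
open import Data.Bool using (Bool; true; false)
open import Data.Sum using (_⊎_; inj₁; inj₂)
open import Data.Product using (Σ; ∃; ∃-syntax; _×_; _,_)
open import Data.Empty using (⊥)
open import Relation.Nullary using (¬_)
open import Relation.Binary.PropositionalEquality using (_≡_)
open import Relation.Binary.Structures using (IsEquivalence)
open import Function.Bundles using (_⇔_)

Atm₀ : Set
Atm₀ = ℕ

Val : ℕ → Set
Val n = Fin n

-- Atm = Atm₀ ∪ Dec, where inj₂ x stands for the decision atom t(x).
Atm : ℕ → Set
Atm n = Atm₀ ⊎ Val n

data Form (n : ℕ) : Set where
  atom : Atm₀ → Form n
  t    : Val n → Form n
  ¬′_  : Form n → Form n
  _∧′_ : Form n → Form n → Form n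
  □I   : Form n → Form n
  □F   : Form n → Form n

-- A finite quasi-MDM with k worlds (W = Fin k). Relations and valuation are
-- Boolean-valued (i.e. given as characteristic functions of subsets).
record QMDM (n k : ℕ) : Set where
  field
    RI  : Fin k → Fin k → Bool
    RF  : Fin k → Fin k → Bool
    V   : Fin k → Atm n → Bool
    eqI : IsEquivalence (λ w v → RI w v ≡ true)
    eqF : IsEquivalence (λ w v → RF w v ≡ true)
    C1  : ∀ w v → (∃[ u ] (RI w u ≡ true × RF u v ≡ true))
                ⇔ (∃[ u ] (RF w u ≡ true × RI u v ≡ true))
    C3  : ∀ w v → RF w v ≡ true → ∀ (p : Atm₀) → V w (inj₁ p) ≡ V v (inj₁ p)
    C4  : ∀ w (x y : Val n) → V w (inj₂ x) ≡ true → ¬ (x ≡ y) → V w (inj₂ y) ≡ false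
    C5  : ∀ w → ∃[ x ] (V w (inj₂ x) ≡ true)

IsMDM : ∀ {n k} → QMDM n k → Set
IsMDM {n} M = ∀ w v → (∀ (p : Atm₀) → V w (inj₁ p) ≡ V v (inj₁ p)) → RI w v ≡ true
          → ∀ (x : Val n) → V w (inj₂ x) ≡ V v (inj₂ x)
  where open QMDM M

_,_⊨_ : ∀ {n k} → QMDM n k → Fin k → Form n → Set
M , w ⊨ atom p   = QMDM.V M w (inj₁ p) ≡ true
M , w ⊨ t x      = QMDM.V M w (inj₂ x) ≡ true
M , w ⊨ (¬′ φ)   = ¬ (M , w ⊨ φ)
M , w ⊨ (φ ∧′ ψ) = (M , w ⊨ φ) × (M , w ⊨ ψ)
M , w ⊨ □I φ     = ∀ v → QMDM.RI M w v ≡ true → M , v ⊨ φ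
M , w ⊨ □F φ     = ∀ v → QMDM.RF M w v ≡ true → M , v ⊨ φ

SatFinMDM : ∀ {n} → Form n → Set
SatFinMDM {n} φ = ∃[ k ] Σ (QMDM n k) (λ M → IsMDM M × ∃[ w ] (M , w ⊨ φ))

SatFinQMDM : ∀ {n} → Form n → Set
SatFinQMDM {n} φ = ∃[ k ] Σ (QMDM n k) (λ M → ∃[ w ] (M , w ⊨ φ))

{-# OPTIONS --safe #-}
-- Only (C2) separates MDMs from quasi-MDMs, and it is forced in two steps.
-- First M is unravelled: a world of the new model is a pair of tagged worlds
-- (p , q) standing for a chosen point that is ∼F-related to p and ∼I-related
-- to q; ∼F′ fixes p and ∼I′ fixes q, so ∼I′ ∩ ∼F′ is the identity, and the
-- projection to M is a bounded morphism, hence preserves truth. Second, the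
-- atoms that φ does not mention name each world's ∼F-class, so worlds
-- agreeing on Atm₀ are ∼F-related, and (C2) reduces to ∼I′ ∩ ∼F′ being
-- trivial.
module Submission where

open import Defs
open import Data.Nat using (ℕ; suc; _+_; _*_; _∸_; _<_; _≤_)
open import Data.Nat.Properties using (_<?_; <-≤-trans; ≤-refl; m≤m+n; m≤n+m; m+n≮m; m+n∸m≡n)
open import Data.Fin using (Fin; toℕ; fromℕ<)
open import Data.Fin.Properties using (any?; toℕ<n; fromℕ<-toℕ; *↔×; 2↔Bool) renaming (_≟_ to _≟ᶠ_)
open import Data.Bool using (Bool; true; false; not; if_then_else_)
open import Data.Bool.Properties using (⇔→≡; not-¬) renaming (_≟_ to _≟ᵇ_)
open import Data.Unit using (⊤; tt)
open import Data.Sum using (_⊎_; inj₁; inj₂)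
open import Data.Product using (Σ; ∃; ∃-syntax; _×_; _,_; proj₁; proj₂)
open import Data.Product.Properties using (≡-dec; ×-≡,≡→≡)
open import Data.Product.Function.NonDependent.Propositional using (_×-⇔_; _×-↔_)
open import Data.Empty using (⊥-elim)
open import Function using (id; _∘_)
open import Function.Bundles using (_⇔_; mk⇔; Equivalence; _↔_; Inverse)
open import Function.Construct.Identity using (↔-id)
open import Function.Construct.Composition using (_↔-∘_)
open import Function.Related.TypeIsomorphisms using (¬-cong-⇔)
open import Relation.Nullary using (Dec; yes; no; does)
open import Relation.Nullary.Decidable using (_×-dec_; _⊎-dec_; dec-true; dec-false)
open import Relation.Binary.PropositionalEquality using (_≡_; refl; sym; trans; cong; subst; module ≡-Reasoning)
open import Relation.Binary.Structures using (IsEquivalence)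
open import Relation.Binary.Definitions using (Decidable)

AtomsBelow : ∀ {n} → ℕ → Form n → Set
AtomsBelow N (atom p) = p < N
AtomsBelow N (t x)    = ⊤
AtomsBelow N (¬′ φ)   = AtomsBelow N φ
AtomsBelow N (φ ∧′ ψ) = AtomsBelow N φ × AtomsBelow N ψ
AtomsBelow N (□I φ)   = AtomsBelow N φ
AtomsBelow N (□F φ)   = AtomsBelow N φ

atomBound : ∀ {n} → Form n → ℕ
atomBound (atom p) = suc p
atomBound (t x)    = 0
atomBound (¬′ φ)   = atomBound φ
atomBound (φ ∧′ ψ) = atomBound φ + atomBound ψ
atomBound (□I φ)   = atomBound φ
atomBound (□F φ)   = atomBound φ

AtomsBelow-mono : ∀ {n N N′} (φ : Form n) → N ≤ N′ → AtomsBelow N φ → AtomsBelow N′ φ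
AtomsBelow-mono (atom p) N≤N′ p<N        = <-≤-trans p<N N≤N′
AtomsBelow-mono (t x)    N≤N′ _          = tt
AtomsBelow-mono (¬′ φ)   N≤N′ b          = AtomsBelow-mono φ N≤N′ b
AtomsBelow-mono (φ ∧′ ψ) N≤N′ (bφ , bψ)  = AtomsBelow-mono φ N≤N′ bφ , AtomsBelow-mono ψ N≤N′ bψ
AtomsBelow-mono (□I φ)   N≤N′ b          = AtomsBelow-mono φ N≤N′ b
AtomsBelow-mono (□F φ)   N≤N′ b          = AtomsBelow-mono φ N≤N′ b

atomsBelow-atomBound : ∀ {n} (φ : Form n) → AtomsBelow (atomBound φ) φ
atomsBelow-atomBound (atom p) = ≤-refl
atomsBelow-atomBound (t x)    = tt
atomsBelow-atomBound (¬′ φ)   = atomsBelow-atomBound φ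
atomsBelow-atomBound (φ ∧′ ψ) =
  AtomsBelow-mono φ (m≤m+n _ _) (atomsBelow-atomBound φ) ,
  AtomsBelow-mono ψ (m≤n+m _ _) (atomsBelow-atomBound ψ)
atomsBelow-atomBound (□I φ)   = atomsBelow-atomBound φ
atomsBelow-atomBound (□F φ)   = atomsBelow-atomBound φ

record Zigzag {k′ k : ℕ} (Dom : Fin k′ → Set) (f : Fin k′ → Fin k)
              (R′ : Fin k′ → Fin k′ → Bool) (R : Fin k → Fin k → Bool) : Set where
  field
    forth : ∀ {i j} → Dom i → R′ i j ≡ true → Dom j × R (f i) (f j) ≡ true
    back  : ∀ {i v} → Dom i → R (f i) v ≡ true → ∃[ j ] (R′ i j ≡ true × f j ≡ v)

zigzag-id : ∀ {k} (R : Fin k → Fin k → Bool) → Zigzag (λ _ → ⊤) id R R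
zigzag-id R = record { forth = λ _ r → tt , r ; back = λ {_} {v} _ r → v , r , refl }

□-cong-⇔ : ∀ {k′ k} {Dom : Fin k′ → Set} {f : Fin k′ → Fin k} {R′ R} → Zigzag Dom f R′ R →
           {P′ : Fin k′ → Set} {P : Fin k → Set} → (∀ {j} → Dom j → P′ j ⇔ P (f j)) →
           ∀ {i} → Dom i → (∀ j → R′ i j ≡ true → P′ j) ⇔ (∀ v → R (f i) v ≡ true → P v)
□-cong-⇔ {f = f} {R′} {R} zz {P′} {P} P′⇔P {i} i∈ = mk⇔ to from
  where
  open Zigzag zz

  to : (∀ j → R′ i j ≡ true → P′ j) → ∀ v → R (f i) v ≡ true → P v
  to H v r with back i∈ r
  ... | j , r′ , refl = Equivalence.to (P′⇔P (proj₁ (forth i∈ r′))) (H j r′)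

  from : (∀ v → R (f i) v ≡ true → P v) → ∀ j → R′ i j ≡ true → P′ j
  from H j r′ with forth i∈ r′
  ... | j∈ , r = Equivalence.from (P′⇔P j∈) (H (f j) r)

record BoundedMorphism {n k′ k : ℕ} (N : ℕ) (M′ : QMDM n k′) (M : QMDM n k) : Set₁ where
  field
    Dom             : Fin k′ → Set
    map             : Fin k′ → Fin k
    zigzagI         : Zigzag Dom map (QMDM.RI M′) (QMDM.RI M)
    zigzagF         : Zigzag Dom map (QMDM.RF M′) (QMDM.RF M)
    atoms-agree     : ∀ {i} → Dom i → ∀ {p} → p < N → QMDM.V M′ i (inj₁ p) ≡ QMDM.V M (map i) (inj₁ p)
    decisions-agree : ∀ {i} → Dom i → ∀ x → QMDM.V M′ i (inj₂ x) ≡ QMDM.V M (map i) (inj₂ x)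

≡true-cong : ∀ {a b : Bool} → a ≡ b → (a ≡ true) ⇔ (b ≡ true)
≡true-cong a≡b = mk⇔ (trans (sym a≡b)) (trans a≡b)

module _ {n k′ k N} {M′ : QMDM n k′} {M : QMDM n k} (h : BoundedMorphism N M′ M) where
  open BoundedMorphism h

  ⊨-preserved : ∀ φ → AtomsBelow N φ → ∀ {i} → Dom i → (M′ , i ⊨ φ) ⇔ (M , map i ⊨ φ)
  ⊨-preserved (atom p) p<N i∈ = ≡true-cong (atoms-agree i∈ p<N)
  ⊨-preserved (t x)    _   i∈ = ≡true-cong (decisions-agree i∈ x)
  ⊨-preserved (¬′ φ)   b   i∈ = ¬-cong-⇔ (⊨-preserved φ b i∈)
  ⊨-preserved (φ ∧′ ψ) (bφ , bψ) i∈ = ⊨-preserved φ bφ i∈ ×-⇔ ⊨-preserved ψ bψ i∈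
  ⊨-preserved (□I φ)   b   i∈ = □-cong-⇔ zigzagI (⊨-preserved φ b) i∈
  ⊨-preserved (□F φ)   b   i∈ = □-cong-⇔ zigzagF (⊨-preserved φ b) i∈

does-sound : ∀ {A : Set} (a? : Dec A) → does a? ≡ true → A
does-sound (yes a) _ = a
does-sound (no _) ()

module PullBack {A : Set} {K : ℕ} (e : Fin K ↔ A) where
  open Inverse e using (to; from; strictlyInverseˡ)

  pull : {R : A → A → Set} → Decidable R → Fin K → Fin K → Bool
  pull R? i j = does (R? (to i) (to j))

  module _ {R : A → A → Set} (R? : Decidable R) where

    pull-sound : ∀ {i j} → pull R? i j ≡ true → R (to i) (to j)
    pull-sound = does-sound (R? _ _)

    pull-complete : ∀ {i j} → R (to i) (to j) → pull R? i j ≡ true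
    pull-complete = dec-true (R? _ _)

    pull-completeʳ : ∀ {i b} → R (to i) b → pull R? i (from b) ≡ true
    pull-completeʳ {i} {b} r = pull-complete (subst (R (to i)) (sym (strictlyInverseˡ b)) r)

    pull-completeˡ : ∀ {a j} → R a (to j) → pull R? (from a) j ≡ true
    pull-completeˡ {a} {j} r = pull-complete (subst (λ x → R x (to j)) (sym (strictlyInverseˡ a)) r)

    pull-isEquivalence : IsEquivalence R → IsEquivalence (λ i j → pull R? i j ≡ true)
    pull-isEquivalence isEq = record
      { refl  = pull-complete R.refl
      ; sym   = λ r → pull-complete (R.sym (pull-sound r))
      ; trans = λ r s → pull-complete (R.trans (pull-sound r) (pull-sound s))
      }
      where module R = IsEquivalence isEq

    pull-zigzag : ∀ {k} {Dom : A → Set} {f : A → Fin k} {Rₖ : Fin k → Fin k → Bool} →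
                  (∀ {a b} → Dom a → R a b → Dom b × Rₖ (f a) (f b) ≡ true) →
                  (∀ {a v} → Dom a → Rₖ (f a) v ≡ true → ∃[ b ] (R a b × f b ≡ v)) →
                  Zigzag (Dom ∘ to) (f ∘ to) (pull R?) Rₖ
    pull-zigzag {f = f} forth back = record
      { forth = λ i∈ r → forth i∈ (pull-sound r)
      ; back  = λ i∈ r → let b , ab , fb≡v = back i∈ r in
                  from b , pull-completeʳ ab , trans (cong f (strictlyInverseˡ b)) fb≡v
      }

  pull-commute : ∀ {R S : A → A → Set} (R? : Decidable R) (S? : Decidable S) →
                 (∀ {a b c} → R a b → S b c → ∃[ d ] (S a d × R d c)) →
                 ∀ {i j} → ∃[ l ] (pull R? i l ≡ true × pull S? l j ≡ true) →
                 ∃[ m ] (pull S? i m ≡ true × pull R? m j ≡ true)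
  pull-commute R? S? comm (l , il , lj) =
    let d , ad , dc = comm (pull-sound R? il) (pull-sound S? lj) in
    from d , pull-completeʳ S? ad , pull-completeˡ R? dc

DecisionsConstantOnI∩F : ∀ {n k} → QMDM n k → Set
DecisionsConstantOnI∩F {n} M =
  ∀ w v → RI w v ≡ true → RF w v ≡ true → ∀ (x : Val n) → V w (inj₂ x) ≡ V v (inj₂ x)
  where open QMDM M

module Recoding {n k : ℕ} (M : QMDM n k) (N : ℕ) where
  open QMDM M
  private module ∼F = IsEquivalence eqF

  fClassAt : Fin k → ℕ → Bool
  fClassAt w j with j <? k
  ... | yes j<k = RF w (fromℕ< j<k)
  ... | no _    = false

  -- Atom N + j holds at w iff w ∼F j: here the infinitude of Atm₀ is used.
  V′ : Fin k → Atm n → Bool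
  V′ w (inj₁ p) with p <? N
  ... | yes _ = V w (inj₁ p)
  ... | no _  = fClassAt w (p ∸ N)
  V′ w (inj₂ x) = V w (inj₂ x)

  V′-below : ∀ w {p} → p < N → V′ w (inj₁ p) ≡ V w (inj₁ p)
  V′-below w {p} p<N with p <? N
  ... | yes _   = refl
  ... | no p≮N = ⊥-elim (p≮N p<N)

  fClassAt-toℕ : ∀ w v → fClassAt w (toℕ v) ≡ RF w v
  fClassAt-toℕ w v with toℕ v <? k
  ... | yes v<k = cong (RF w) (fromℕ<-toℕ v v<k)
  ... | no v≮k = ⊥-elim (v≮k (toℕ<n v))

  V′-above : ∀ w v → V′ w (inj₁ (N + toℕ v)) ≡ RF w v
  V′-above w v with N + toℕ v <? N
  ... | yes N+v<N = ⊥-elim (m+n≮m N _ N+v<N)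
  ... | no _      = trans (cong (fClassAt w) (m+n∸m≡n N (toℕ v))) (fClassAt-toℕ w v)

  fClassAt-cong : ∀ {w w′} → RF w w′ ≡ true → ∀ j → fClassAt w j ≡ fClassAt w′ j
  fClassAt-cong w∼w′ j with j <? k
  ... | yes j<k = ⇔→≡ (mk⇔ (∼F.trans (∼F.sym w∼w′)) (∼F.trans w∼w′))
  ... | no _    = refl

  V′-C3 : ∀ w w′ → RF w w′ ≡ true → ∀ p → V′ w (inj₁ p) ≡ V′ w′ (inj₁ p)
  V′-C3 w w′ w∼w′ p with p <? N
  ... | yes _ = C3 w w′ w∼w′ p
  ... | no _  = fClassAt-cong w∼w′ (p ∸ N)

  recoded : QMDM n k
  recoded = record
    { RI = RI ; RF = RF ; V = V′ ; eqI = eqI ; eqF = eqF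
    ; C1 = C1 ; C3 = V′-C3 ; C4 = C4 ; C5 = C5 }

  recoded-bounded : BoundedMorphism N recoded M
  recoded-bounded = record
    { Dom = λ _ → ⊤ ; map = id ; zigzagI = zigzag-id RI ; zigzagF = zigzag-id RF
    ; atoms-agree = λ {w} _ → V′-below w ; decisions-agree = λ _ _ → refl }

  recoded-isMDM : DecisionsConstantOnI∩F M → IsMDM recoded
  recoded-isMDM decisive w v same-atoms w∼Iv = decisive w v w∼Iv w∼Fv
    where
    open ≡-Reasoning
    w∼Fv : RF w v ≡ true
    w∼Fv = begin
      RF w v                    ≡⟨ V′-above w v ⟨
      V′ w (inj₁ (N + toℕ v))   ≡⟨ same-atoms (N + toℕ v) ⟩
      V′ v (inj₁ (N + toℕ v))   ≡⟨ V′-above v v ⟩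
      RF v v                    ≡⟨ ∼F.refl ⟩
      true                      ∎

module Unravelling {n k : ℕ} (M : QMDM n k) where
  open QMDM M
  private
    module ∼I = IsEquivalence eqI
    module ∼F = IsEquivalence eqF

  MeetingPoint : Fin k → Fin k → Fin k → Set
  MeetingPoint x y u = RF x u ≡ true × RI u y ≡ true

  Meet : Fin k → Fin k → Set
  Meet x y = ∃ (MeetingPoint x y)

  meet? : Decidable Meet
  meet? x y = any? λ u → (RF x u ≟ᵇ true) ×-dec (RI u y ≟ᵇ true)

  meet-rectangle : ∀ {x x′ y y′} → Meet x y → Meet x′ y → Meet x′ y′ → Meet x y′
  meet-rectangle (u , x∼u , u∼y) (u′ , x′∼u′ , u′∼y) (u″ , x′∼u″ , u″∼y′)
    with Equivalence.to (C1 u u″) (u′ , ∼I.trans u∼y (∼I.sym u′∼y) , ∼F.trans (∼F.sym x′∼u′) x′∼u″)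
  ... | v , u∼v , v∼u″ = v , ∼F.trans x∼u u∼v , ∼I.trans v∼u″ u″∼y′

  meetingPoint : Fin k → Fin k → Fin k
  meetingPoint x y with meet? x y
  ... | yes (u , _) = u
  ... | no _        = x

  meetingPoint-meets : ∀ {x y} → Meet x y → MeetingPoint x y (meetingPoint x y)
  meetingPoint-meets {x} {y} m with meet? x y
  ... | yes (_ , u-meets) = u-meets
  ... | no ¬m             = ⊥-elim (¬m m)

  Tagged : Set
  Tagged = Fin k × Bool

  -- A site ((x , s) , (y , s′)) stands for a meeting point of x and y; the
  -- tags only decide which one: x itself if s ≡ s′ and x ∼I y, y itself if
  -- s ≢ s′ and y ∼F x. This freedom is what makes the back conditions hold.
  Site : Set
  Site = Tagged × Tagged

  choose : Bool → Fin k → Fin k → Fin k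
  choose true  x y = if RI x y then x else meetingPoint x y
  choose false x y = if RF y x then y else meetingPoint x y

  choose-meets : ∀ b {x y} → Meet x y → MeetingPoint x y (choose b x y)
  choose-meets true {x} {y} m with RI x y in x∼y
  ... | true  = ∼F.refl , x∼y
  ... | false = meetingPoint-meets m
  choose-meets false {x} {y} m with RF y x in y∼x
  ... | true  = ∼F.sym y∼x , ∼I.refl
  ... | false = meetingPoint-meets m

  choose-∼I : ∀ {x y} → RI x y ≡ true → choose true x y ≡ x
  choose-∼I x∼y rewrite x∼y = refl

  choose-∼F : ∀ {x y} → RF y x ≡ true → choose false x y ≡ y
  choose-∼F y∼x rewrite y∼x = refl

  point : Site → Fin k
  point ((x , s) , (y , s′)) = choose (does (s ≟ᵇ s′)) x y

  Good : Site → Set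
  Good ((x , _) , (y , _)) = Meet x y

  good? : ∀ a → Dec (Good a)
  good? ((x , _) , (y , _)) = meet? x y

  point-meets : ∀ a → Good a → MeetingPoint (proj₁ (proj₁ a)) (proj₁ (proj₂ a)) (point a)
  point-meets ((_ , s) , (_ , s′)) = choose-meets (does (s ≟ᵇ s′))

  Linked : (Site → Tagged) → Site → Site → Set
  Linked anchor a b = (Good a × Good b × anchor a ≡ anchor b) ⊎ a ≡ b

  _∼I′_ : Site → Site → Set
  _∼I′_ = Linked proj₂

  _∼F′_ : Site → Site → Set
  _∼F′_ = Linked proj₁

  linked? : ∀ anchor → Decidable (Linked anchor)
  linked? anchor a b = (good? a ×-dec good? b ×-dec anchor a ≟ₜ anchor b) ⊎-dec ≡-dec _≟ₜ_ _≟ₜ_ a b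
    where
    _≟ₜ_ : (s s′ : Tagged) → Dec (s ≡ s′)
    _≟ₜ_ = ≡-dec _≟ᶠ_ _≟ᵇ_

  Linked-isEquivalence : ∀ anchor → IsEquivalence (Linked anchor)
  Linked-isEquivalence anchor = record { refl = inj₂ refl ; sym = linked-sym ; trans = linked-trans }
    where
    linked-sym : ∀ {a b} → Linked anchor a b → Linked anchor b a
    linked-sym (inj₁ (ga , gb , e)) = inj₁ (gb , ga , sym e)
    linked-sym (inj₂ e)             = inj₂ (sym e)

    linked-trans : ∀ {a b c} → Linked anchor a b → Linked anchor b c → Linked anchor a c
    linked-trans ab (inj₂ refl) = ab
    linked-trans (inj₂ refl) bc = bc
    linked-trans (inj₁ (ga , _ , e)) (inj₁ (_ , gc , e′)) = inj₁ (ga , gc , trans e e′)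

  linked-good : ∀ {anchor a b} → Good a → Linked anchor a b → Good b
  linked-good _  (inj₁ (_ , gb , _)) = gb
  linked-good ga (inj₂ refl)         = ga

  ∼I′⇒∼I : ∀ {a b} → a ∼I′ b → RI (point a) (point b) ≡ true
  ∼I′⇒∼I {a} {b} (inj₁ (ga , gb , refl)) =
    ∼I.trans (proj₂ (point-meets a ga)) (∼I.sym (proj₂ (point-meets b gb)))
  ∼I′⇒∼I (inj₂ refl) = ∼I.refl

  ∼F′⇒∼F : ∀ {a b} → a ∼F′ b → RF (point a) (point b) ≡ true
  ∼F′⇒∼F {a} {b} (inj₁ (ga , gb , refl)) =
    ∼F.trans (∼F.sym (proj₁ (point-meets a ga))) (proj₁ (point-meets b gb))
  ∼F′⇒∼F (inj₂ refl) = ∼F.refl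

  ∼I′∘∼F′⊆∼F′∘∼I′ : ∀ {a b c} → a ∼I′ b → b ∼F′ c → ∃[ d ] (a ∼F′ d × d ∼I′ c)
  ∼I′∘∼F′⊆∼F′∘∼I′ {c = c} (inj₂ refl) bc = c , bc , inj₂ refl
  ∼I′∘∼F′⊆∼F′∘∼I′ {a} ab (inj₂ refl) = a , inj₂ refl , ab
  ∼I′∘∼F′⊆∼F′∘∼I′ {p , _} {_ , _} {_ , q₂} (inj₁ (ga , gb , refl)) (inj₁ (_ , gc , refl)) =
    (p , q₂) , inj₁ (ga , gd , refl) , inj₁ (gd , gc , refl)
    where gd = meet-rectangle ga gb gc

  ∼F′∘∼I′⊆∼I′∘∼F′ : ∀ {a b c} → a ∼F′ b → b ∼I′ c → ∃[ d ] (a ∼I′ d × d ∼F′ c)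
  ∼F′∘∼I′⊆∼I′∘∼F′ {c = c} (inj₂ refl) bc = c , bc , inj₂ refl
  ∼F′∘∼I′⊆∼I′∘∼F′ {a} ab (inj₂ refl) = a , inj₂ refl , ab
  ∼F′∘∼I′⊆∼I′∘∼F′ {_ , q} {_ , _} {p₂ , _} (inj₁ (ga , gb , refl)) (inj₁ (_ , gc , refl)) =
    (p₂ , q) , inj₁ (ga , gd , refl) , inj₁ (gd , gc , refl)
    where gd = meet-rectangle gc gb ga

  ∼I′∩∼F′⇒≡ : ∀ {a b} → a ∼I′ b → a ∼F′ b → a ≡ b
  ∼I′∩∼F′⇒≡ (inj₂ a≡b) _ = a≡b
  ∼I′∩∼F′⇒≡ _ (inj₂ a≡b) = a≡b
  ∼I′∩∼F′⇒≡ (inj₁ (_ , _ , q≡q′)) (inj₁ (_ , _ , p≡p′)) = ×-≡,≡→≡ (p≡p′ , q≡q′)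

  ∼I′-back : ∀ {a v} → Good a → RI (point a) v ≡ true → ∃[ b ] (a ∼I′ b × point b ≡ v)
  ∼I′-back {a@(_ , (y , s))} {v} ga a∼v =
    ((v , s) , (y , s)) , inj₁ (ga , (v , ∼F.refl , v∼y) , refl) , point≡v
    where
    v∼y : RI v y ≡ true
    v∼y = ∼I.trans (∼I.sym a∼v) (proj₂ (point-meets a ga))
    point≡v : choose (does (s ≟ᵇ s)) v y ≡ v
    point≡v = trans (cong (λ b → choose b v y) (dec-true (s ≟ᵇ s) refl)) (choose-∼I v∼y)

  ∼F′-back : ∀ {a v} → Good a → RF (point a) v ≡ true → ∃[ b ] (a ∼F′ b × point b ≡ v)
  ∼F′-back {a@((x , s) , _)} {v} ga a∼v =
    ((x , s) , (v , not s)) , inj₁ (ga , (v , ∼F.sym v∼x , ∼I.refl) , refl) , point≡v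
    where
    v∼x : RF v x ≡ true
    v∼x = ∼F.trans (∼F.sym a∼v) (∼F.sym (proj₁ (point-meets a ga)))
    point≡v : choose (does (s ≟ᵇ not s)) x v ≡ v
    point≡v = trans (cong (λ b → choose b x v) (dec-false (s ≟ᵇ not s) (not-¬ refl))) (choose-∼F v∼x)

  sites : Fin ((k * 2) * (k * 2)) ↔ Site
  sites = (tagged ×-↔ tagged) ↔-∘ *↔×
    where
    tagged : Fin (k * 2) ↔ Tagged
    tagged = (↔-id (Fin k) ×-↔ 2↔Bool) ↔-∘ *↔×

  open Inverse sites using () renaming (to to site; from to index; strictlyInverseˡ to site-index)
  open PullBack sites

  unravelled : QMDM n ((k * 2) * (k * 2))
  unravelled = record
    { RI  = pull (linked? proj₂)
    ; RF  = pull (linked? proj₁)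
    ; V   = V ∘ point ∘ site
    ; eqI = pull-isEquivalence (linked? proj₂) (Linked-isEquivalence proj₂)
    ; eqF = pull-isEquivalence (linked? proj₁) (Linked-isEquivalence proj₁)
    ; C1  = λ _ _ → mk⇔ (pull-commute (linked? proj₂) (linked? proj₁) ∼I′∘∼F′⊆∼F′∘∼I′)
                        (pull-commute (linked? proj₁) (linked? proj₂) ∼F′∘∼I′⊆∼I′∘∼F′)
    ; C3  = λ _ _ r → C3 _ _ (∼F′⇒∼F (pull-sound (linked? proj₁) r))
    ; C4  = λ i → C4 (point (site i))
    ; C5  = λ i → C5 (point (site i))
    }

  unravelled-decisive : DecisionsConstantOnI∩F unravelled
  unravelled-decisive _ _ ri rf x =
    cong (λ a → V (point a) (inj₂ x))
         (∼I′∩∼F′⇒≡ (pull-sound (linked? proj₂) ri) (pull-sound (linked? proj₁) rf))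

  unravelled-bounded : ∀ N → BoundedMorphism N unravelled M
  unravelled-bounded N = record
    { Dom = Good ∘ site
    ; map = point ∘ site
    ; zigzagI = pull-zigzag (linked? proj₂) (λ ga ab → linked-good ga ab , ∼I′⇒∼I ab) ∼I′-back
    ; zigzagF = pull-zigzag (linked? proj₁) (λ ga ab → linked-good ga ab , ∼F′⇒∼F ab) ∼F′-back
    ; atoms-agree = λ _ _ → refl
    ; decisions-agree = λ _ _ → refl
    }

  root : Fin k → Fin ((k * 2) * (k * 2))
  root w = index ((w , true) , (w , true))

  root-good : ∀ w → Good (site (root w))
  root-good w = subst Good (sym (site-index _)) (w , ∼F.refl , ∼I.refl)

  point-root : ∀ w → point (site (root w)) ≡ w
  point-root w = trans (cong point (site-index _)) (choose-∼I ∼I.refl)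

SatFinDecisive : ∀ {n} → Form n → Set
SatFinDecisive {n} φ = ∃[ k ] Σ (QMDM n k) (λ M → DecisionsConstantOnI∩F M × ∃[ w ] (M , w ⊨ φ))

unravel-sat : ∀ {n} (φ : Form n) → SatFinQMDM φ → SatFinDecisive φ
unravel-sat φ (k , M , w , w⊨φ) =
  _ , unravelled , unravelled-decisive , root w ,
  Equivalence.from (⊨-preserved (unravelled-bounded (atomBound φ)) φ (atomsBelow-atomBound φ) (root-good w))
                   (subst (λ v → M , v ⊨ φ) (sym (point-root w)) w⊨φ)
  where open Unravelling M

recode-sat : ∀ {n} (φ : Form n) → SatFinDecisive φ → SatFinMDM φ
recode-sat φ (k , M , decisive , w , w⊨φ) =
  k , recoded , recoded-isMDM decisive , w ,
  Equivalence.from (⊨-preserved recoded-bounded φ (atomsBelow-atomBound φ) tt) w⊨φ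
  where open Recoding M (atomBound φ)

theorem3 : (n : ℕ) (φ : Form n) → SatFinMDM φ ⇔ SatFinQMDM φ
theorem3 n φ = mk⇔ forget (recode-sat φ ∘ unravel-sat φ)
  where
  forget : SatFinMDM φ → SatFinQMDM φ
  forget (k , M , _ , w , w⊨φ) = k , M , w , w⊨φ
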